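{- Let $G$ be a group, and let categories fibered in groupoids $\mathfrak{X},\mathfrak{Y}$ carry weak right $G$-actions $(\mu_{\mathfrak{X}},\alpha,a)$ and $(\mu_{\mathfrak{Y}},\beta,b)$. Let $(F,\sigma),(H,\tau):\mathfrak{X}\to\mathfrak{Y}$ be $G$-equivariant morphisms and $\Lambda:(F,\sigma)\Rightarrow(H,\tau)$ a $G$-equivariant 2-morphism. Then $\Lambda$ induces a 2-morphism $\lfloor\Lambda\rfloor:\lfloor F\rfloor\Rightarrow\lfloor H\rfloor$ between the induced morphisms of transformation groupoids $\lfloor\mathfrak{X}/G\rfloor\to\lfloor\mathfrak{Y}/G\rfloor$, defined by $\lfloor\Lambda\rfloor^x=(b^{H(x)}\circ\Lambda^x,e)$.
   Context: A weak right action: $\mu:\mathfrak{X}\times G\to\mathfrak{X}$, $x\cdot g:=\mu(x,g)$, with natural isomorphisms $\alpha^x_{g,h}:x\cdot g\cdot h\to x\cdot gh$ and $a^x:x\to x\cdot e$ satisfying $\alpha^x_{gh,k}\circ(\alpha^x_{g,h}\cdot k)=\alpha^x_{g,hk}\circ\alpha^{x\cdot g}_{h,k}$, $1_{x\cdot g}=\alpha^x_{e,g}\circ(a^x\cdot g)$, $1_{x\cdot g}=\alpha^x_{g,e}\circ a^{x\cdot g}$. An equivariant morphism $(F,\sigma)$ is a morphism $F$ with natural isomorphisms $\sigma^x_g:F(x)\cdot g\to F(x\cdot g)$ satisfying $F(\alpha^x_{g,h})\circ\sigma^{x\cdot g}_h\circ(\sigma^x_g\cdot h)=\sigma^x_{gh}\circ\beta^{F(x)}_{g,h}$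 and $(\sigma^x_e)^{ -1}\circ F(a^x)=b^{F(x)}$. An equivariant 2-morphism $\Lambda:(F,\sigma)\Rightarrow(H,\tau)$ is a natural transformation with $\tau^x_g\circ(\Lambda^x\cdot g)=\Lambda^{x\cdot g}\circ\sigma^x_g$. The transformation groupoid $\lfloor\mathfrak{X}/G\rfloor$ has the objects of $\mathfrak{X}$, morphisms $x\to y$ the pairs $(\gamma,g)$ with $g\in G$, $\gamma:x\to y\cdot g$, and composition $(\delta,h)\circ(\gamma,g)=(\alpha^z_{h,g}\circ(\delta\cdot g)\circ\gamma,hg)$. $\lfloor F\rfloor$ acts as $F$ on objects and sends $(\gamma,g):x\to y$ to $((\sigma^y_g)^{ -1}\circ F(\gamma),g)$. -}

module Defs where

open import Level using (Level; _⊔_) renaming (suc to lsuc)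
open import Data.Product using (Σ; _,_; _×_; proj₁; proj₂)
open import Relation.Binary.PropositionalEquality
  using (_≡_; refl; sym; trans; subst; subst₂; cong)
open import Algebra.Core using (Op₁; Op₂)
open import Algebra.Structures using (IsGroup)

record Category (o ℓ : Level) : Set (lsuc (o ⊔ ℓ)) where
  infixr 9 _∘_
  field
    Obj : Set o
    Hom : Obj → Obj → Set ℓ
    id  : ∀ {A} → Hom A A
    _∘_ : ∀ {A B C} → Hom B C → Hom A B → Hom A C
    assoc : ∀ {A B C D} {f : Hom A B} {g : Hom B C} {h : Hom C D} →
            (h ∘ g) ∘ f ≡ h ∘ (g ∘ f)
    identityˡ : ∀ {A B} {f : Hom A B} → id ∘ f ≡ f
    identityʳ : ∀ {A B} {f : Hom A B} → f ∘ id ≡ f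

record Functor {o ℓ o' ℓ'} (C : Category o ℓ) (D : Category o' ℓ')
       : Set (o ⊔ ℓ ⊔ o' ⊔ ℓ') where
  private
    module C = Category C
    module D = Category D
  field
    F₀ : C.Obj → D.Obj
    F₁ : ∀ {A B} → C.Hom A B → D.Hom (F₀ A) (F₀ B)
    F-id : ∀ {A} → F₁ (C.id {A}) ≡ D.id
    F-∘ : ∀ {A B E} (f : C.Hom A B) (g : C.Hom B E) →
          F₁ (g C.∘ f) ≡ F₁ g D.∘ F₁ f

-- Categories fibered in groupoids over a base category S
-- (p : 𝔛 → S; every arrow of S with target p(y) lifts, and every arrow
-- of 𝔛 is cartesian: unique factorisation over any given base arrow).

record CFG {os ℓs} (S : Category os ℓs) (o ℓ : Level)
       : Set (lsuc (os ⊔ ℓs ⊔ o ⊔ ℓ)) where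
  field
    Tot : Category o ℓ
    p   : Functor Tot S
  open Category Tot
  private module S = Category S
  open Functor p renaming (F₀ to p₀; F₁ to p₁)
  field
    lift : ∀ {U} (y : Obj) (f : S.Hom U (p₀ y)) →
           Σ Obj λ x → Σ (Hom x y) λ φ → Σ (p₀ x ≡ U) λ q →
             subst (λ V → S.Hom V (p₀ y)) q (p₁ φ) ≡ f
    factor : ∀ {x y z} (φ : Hom x z) (ψ : Hom y z) (h : S.Hom (p₀ x) (p₀ y)) →
             p₁ ψ S.∘ h ≡ p₁ φ →
             Σ (Hom x y) λ χ → (ψ ∘ χ ≡ φ) × (p₁ χ ≡ h)
    factor-unique : ∀ {x y z} (φ : Hom x z) (ψ : Hom y z) (χ χ' : Hom x y) →
             ψ ∘ χ ≡ φ → ψ ∘ χ' ≡ φ → p₁ χ ≡ p₁ χ' → χ ≡ χ'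

module _ {os ℓs o ℓ} {S : Category os ℓs} (𝔛 : CFG S o ℓ) where
  open CFG 𝔛
  open Category Tot

  p₀ : Obj → Category.Obj S
  p₀ = Functor.F₀ p

  p₁ : ∀ {x y} → Hom x y → Category.Hom S (p₀ x) (p₀ y)
  p₁ = Functor.F₁ p

  OverId : ∀ {x y} → Hom x y → p₀ y ≡ p₀ x → Set ℓs
  OverId {x} φ q =
    subst (λ V → Category.Hom S (p₀ x) V) q (p₁ φ) ≡ Category.id S

record CFGMor {os ℓs o ℓ o' ℓ'} {S : Category os ℓs}
       (𝔛 : CFG S o ℓ) (𝔜 : CFG S o' ℓ') : Set (os ⊔ ℓs ⊔ o ⊔ ℓ ⊔ o' ⊔ ℓ') where
  field
    fun : Functor (CFG.Tot 𝔛) (CFG.Tot 𝔜)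
  open Functor fun public
  field
    over₀ : ∀ x → p₀ 𝔜 (F₀ x) ≡ p₀ 𝔛 x
    over₁ : ∀ {x y} (γ : Category.Hom (CFG.Tot 𝔛) x y) →
            subst₂ (Category.Hom S) (over₀ x) (over₀ y) (p₁ 𝔜 (F₁ γ)) ≡ p₁ 𝔛 γ

record WeakAction {os ℓs o ℓ c} {S : Category os ℓs} (𝔛 : CFG S o ℓ)
       {G : Set c} {_∙_ : Op₂ G} {e : G} {_⁻¹ : Op₁ G}
       (isG : IsGroup _≡_ _∙_ e _⁻¹) : Set (os ⊔ ℓs ⊔ o ⊔ ℓ ⊔ c) where
  open Category (CFG.Tot 𝔛)
  field
    -- μ : 𝔛 × G → 𝔛, a morphism of CFGs (G discrete)
    act₀ : Obj → G → Obj
    act₁ : ∀ {x y} (g : G) → Hom x y → Hom (act₀ x g) (act₀ y g)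
    act-id : ∀ {x} g → act₁ g (id {x}) ≡ id
    act-∘  : ∀ {x y z} g (f : Hom x y) (f' : Hom y z) →
             act₁ g (f' ∘ f) ≡ act₁ g f' ∘ act₁ g f
    act-over₀ : ∀ x g → p₀ 𝔛 (act₀ x g) ≡ p₀ 𝔛 x
    act-over₁ : ∀ {x y} g (γ : Hom x y) →
                subst₂ (Category.Hom S) (act-over₀ x g) (act-over₀ y g)
                  (p₁ 𝔛 (act₁ g γ)) ≡ p₁ 𝔛 γ

  castG : ∀ {x g h} → g ≡ h → Hom (act₀ x g) (act₀ x h)
  castG {x} {g} q = subst (λ k → Hom (act₀ x g) (act₀ x k)) q id

  field
    α  : ∀ x g h → Hom (act₀ (act₀ x g) h) (act₀ x (g ∙ h))
    α⁻ : ∀ x g h → Hom (act₀ x (g ∙ h)) (act₀ (act₀ x g) h)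
    α-invˡ : ∀ x g h → α⁻ x g h ∘ α x g h ≡ id
    α-invʳ : ∀ x g h → α x g h ∘ α⁻ x g h ≡ id
    α-nat : ∀ {x y} g h (γ : Hom x y) →
            α y g h ∘ act₁ h (act₁ g γ) ≡ act₁ (g ∙ h) γ ∘ α x g h
    α-over : ∀ x g h → OverId 𝔛 (α x g h)
               (trans (act-over₀ x (g ∙ h))
                 (sym (trans (act-over₀ (act₀ x g) h) (act-over₀ x g))))
    a  : ∀ x → Hom x (act₀ x e)
    a⁻ : ∀ x → Hom (act₀ x e) x
    a-invˡ : ∀ x → a⁻ x ∘ a x ≡ id
    a-invʳ : ∀ x → a x ∘ a⁻ x ≡ id
    a-nat : ∀ {x y} (γ : Hom x y) → a y ∘ γ ≡ act₁ e γ ∘ a x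
    a-over : ∀ x → OverId 𝔛 (a x) (act-over₀ x e)
    coh-assoc : ∀ x g h k →
      castG (IsGroup.assoc isG g h k) ∘ (α x (g ∙ h) k ∘ act₁ k (α x g h))
        ≡ α x g (h ∙ k) ∘ α (act₀ x g) h k
    coh-unitˡ : ∀ x g →
      castG (IsGroup.identityˡ isG g) ∘ (α x e g ∘ act₁ g (a x)) ≡ id
    coh-unitʳ : ∀ x g →
      castG (IsGroup.identityʳ isG g) ∘ (α x g e ∘ a (act₀ x g)) ≡ id

module _ {os ℓs o ℓ o' ℓ' c} {S : Category os ℓs}
         {𝔛 : CFG S o ℓ} {𝔜 : CFG S o' ℓ'}
         {G : Set c} {_∙_ : Op₂ G} {e : G} {_⁻¹ : Op₁ G}
         {isG : IsGroup _≡_ _∙_ e _⁻¹} where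

  private
    module X = Category (CFG.Tot 𝔛)
    module Y = Category (CFG.Tot 𝔜)

  record EqMor (A : WeakAction 𝔛 isG) (B : WeakAction 𝔜 isG)
         : Set (os ⊔ ℓs ⊔ o ⊔ ℓ ⊔ o' ⊔ ℓ' ⊔ c) where
    private
      module A = WeakAction A
      module B = WeakAction B
    field
      mor : CFGMor 𝔛 𝔜
    open CFGMor mor public
    field
      σ  : ∀ x g → Y.Hom (B.act₀ (F₀ x) g) (F₀ (A.act₀ x g))
      σ⁻ : ∀ x g → Y.Hom (F₀ (A.act₀ x g)) (B.act₀ (F₀ x) g)
      σ-invˡ : ∀ x g → σ⁻ x g Y.∘ σ x g ≡ Y.id
      σ-invʳ : ∀ x g → σ x g Y.∘ σ⁻ x g ≡ Y.id
      σ-nat : ∀ {x y} g (γ : X.Hom x y) →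
              σ y g Y.∘ B.act₁ g (F₁ γ) ≡ F₁ (A.act₁ g γ) Y.∘ σ x g
      σ-over : ∀ x g → OverId 𝔜 (σ x g)
                 (trans (over₀ (A.act₀ x g))
                   (trans (A.act-over₀ x g)
                     (trans (sym (over₀ x)) (sym (B.act-over₀ (F₀ x) g)))))
      σ-coh-α : ∀ x g h →
        F₁ (A.α x g h) Y.∘ (σ (A.act₀ x g) h Y.∘ B.act₁ h (σ x g))
          ≡ σ x (g ∙ h) Y.∘ B.α (F₀ x) g h
      σ-coh-a : ∀ x → σ⁻ x e Y.∘ F₁ (A.a x) ≡ B.a (F₀ x)

  record EqTwoMor {A : WeakAction 𝔛 isG} {B : WeakAction 𝔜 isG}
         (F H : EqMor A B) : Set (os ⊔ ℓs ⊔ o ⊔ ℓ ⊔ o' ⊔ ℓ' ⊔ c) where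
    private
      module A = WeakAction A
      module B = WeakAction B
      module F = EqMor F
      module H = EqMor H
    field
      Λ : ∀ x → Y.Hom (F.F₀ x) (H.F₀ x)
      Λ-nat : ∀ {x y} (γ : X.Hom x y) → Λ y Y.∘ F.F₁ γ ≡ H.F₁ γ Y.∘ Λ x
      Λ-over : ∀ x → OverId 𝔜 (Λ x) (trans (H.over₀ x) (sym (F.over₀ x)))
      Λ-eq : ∀ x g →
        H.σ x g Y.∘ B.act₁ g (Λ x) ≡ Λ (A.act₀ x g) Y.∘ F.σ x g

module _ {os ℓs o ℓ c} {S : Category os ℓs} {𝔛 : CFG S o ℓ}
         {G : Set c} {_∙_ : Op₂ G} {e : G} {_⁻¹ : Op₁ G}
         {isG : IsGroup _≡_ _∙_ e _⁻¹} (A : WeakAction 𝔛 isG) where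
  private
    module X = Category (CFG.Tot 𝔛)
    module A = WeakAction A

  THom : X.Obj → X.Obj → Set (ℓ ⊔ c)
  THom x y = Σ G λ g → X.Hom x (A.act₀ y g)

  Tcomp : ∀ {x y z} → THom y z → THom x y → THom x z
  Tcomp {z = z} (h , δ) (g , γ) = (h ∙ g) , (A.α z h g X.∘ (A.act₁ g δ X.∘ γ))

  Tp : ∀ {x y} → THom x y → Category.Hom S (p₀ 𝔛 x) (p₀ 𝔛 y)
  Tp {x} {y} (g , γ) =
    subst (λ V → Category.Hom S (p₀ 𝔛 x) V) (A.act-over₀ y g) (p₁ 𝔛 γ)

module _ {os ℓs o ℓ o' ℓ' c} {S : Category os ℓs}
         {𝔛 : CFG S o ℓ} {𝔜 : CFG S o' ℓ'}
         {G : Set c} {_∙_ : Op₂ G} {e : G} {_⁻¹ : Op₁ G}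
         {isG : IsGroup _≡_ _∙_ e _⁻¹}
         {A : WeakAction 𝔛 isG} {B : WeakAction 𝔜 isG} where
  private
    module Y = Category (CFG.Tot 𝔜)
    module B = WeakAction B

  ⌊_⌋₁ : (F : EqMor A B) → ∀ {x y} → THom A x y →
         THom B (EqMor.F₀ F x) (EqMor.F₀ F y)
  ⌊ F ⌋₁ {y = y} (g , γ) = g , (EqMor.σ⁻ F y g Y.∘ EqMor.F₁ F γ)

  ⌊_⌋₂ : {F H : EqMor A B} → EqTwoMor F H → ∀ x →
         THom B (EqMor.F₀ F x) (EqMor.F₀ H x)
  ⌊_⌋₂ {H = H} Λ x = e , (B.a (EqMor.F₀ H x) Y.∘ EqTwoMor.Λ Λ x)

  -- η is a 2-morphism ⌊F⌋ ⇒ ⌊H⌋ of CFGs ⌊𝔛/G⌋ → ⌊𝔜/G⌋ over S: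
  -- natural w.r.t. all morphisms of ⌊𝔛/G⌋, and componentwise over identities.
  IsTG2Mor : (F H : EqMor A B) →
             (∀ x → THom B (EqMor.F₀ F x) (EqMor.F₀ H x)) → Set (ℓs ⊔ o ⊔ ℓ ⊔ ℓ' ⊔ c)
  IsTG2Mor F H η =
    (∀ {x y} (f : THom A x y) → Tcomp B (η y) (⌊ F ⌋₁ f) ≡ Tcomp B (⌊ H ⌋₁ f) (η x))
    × (∀ x → subst (λ V → Category.Hom S (p₀ 𝔜 (EqMor.F₀ F x)) V)
                   (trans (EqMor.over₀ H x) (sym (EqMor.over₀ F x)))
                   (Tp B (η x))
             ≡ Category.id S)

{-# OPTIONS --safe #-}
module Submission where

open import Defs
open import Level using (Level)
open import Relation.Binary.PropositionalEquality
  using (_≡_; refl; sym; trans; cong; subst; module ≡-Reasoning)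
open import Algebra.Core using (Op₁; Op₂)
open import Algebra.Structures using (IsGroup)
open import Data.Product using (_,_)

-- ⌊Λ⌋^x is the image of Λ^x under the inclusion ι of 𝔜 into ⌊𝔜/G⌋,
-- φ ↦ (b ∘ φ, e).  Composing with ι(φ) on either side just acts by φ,
-- by the unit coherences of the action, so naturality of ⌊Λ⌋ reduces to
-- pasting the equivariance square of Λ (with the σ's inverted) onto its
-- naturality square; and ι(φ) lies over p(φ) because b lies over
-- identities.

module CategoryLemmas {o ℓ : Level} (C : Category o ℓ) where
  open Category C
  open ≡-Reasoning

  cancel₃ˡ : ∀ {A B D E} {f : Hom E B} {g : Hom D E} {h : Hom B D}
             {k : Hom A B} → f ∘ (g ∘ h) ≡ id → f ∘ (g ∘ (h ∘ k)) ≡ k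
  cancel₃ˡ {f = f} {g} {h} {k} fgh≡id = begin
    f ∘ (g ∘ (h ∘ k))  ≡⟨ cong (f ∘_) (sym assoc) ⟩
    f ∘ ((g ∘ h) ∘ k)  ≡⟨ sym assoc ⟩
    (f ∘ (g ∘ h)) ∘ k  ≡⟨ cong (_∘ k) fgh≡id ⟩
    id ∘ k             ≡⟨ identityˡ ⟩
    k                  ∎

  invert-square : ∀ {A B D E} {f : Hom A B} {f⁻ : Hom B A}
                  {g : Hom D E} {g⁻ : Hom E D} {h : Hom A D} {k : Hom B E} →
                  g⁻ ∘ g ≡ id → f ∘ f⁻ ≡ id →
                  g ∘ h ≡ k ∘ f → h ∘ f⁻ ≡ g⁻ ∘ k
  invert-square {f = f} {f⁻} {g} {g⁻} {h} {k} g⁻g≡id ff⁻≡id square = begin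
    h ∘ f⁻                ≡⟨ sym identityˡ ⟩
    id ∘ (h ∘ f⁻)         ≡⟨ cong (_∘ (h ∘ f⁻)) (sym g⁻g≡id) ⟩
    (g⁻ ∘ g) ∘ (h ∘ f⁻)   ≡⟨ assoc ⟩
    g⁻ ∘ (g ∘ (h ∘ f⁻))   ≡⟨ cong (g⁻ ∘_) (sym assoc) ⟩
    g⁻ ∘ ((g ∘ h) ∘ f⁻)   ≡⟨ cong (λ u → g⁻ ∘ (u ∘ f⁻)) square ⟩
    g⁻ ∘ ((k ∘ f) ∘ f⁻)   ≡⟨ cong (g⁻ ∘_) assoc ⟩
    g⁻ ∘ (k ∘ (f ∘ f⁻))   ≡⟨ cong (λ u → g⁻ ∘ (k ∘ u)) ff⁻≡id ⟩
    g⁻ ∘ (k ∘ id)         ≡⟨ cong (g⁻ ∘_) identityʳ ⟩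
    g⁻ ∘ k                ∎

  glue-squares : ∀ {A B D E F K} {a : Hom D F} {b : Hom B D} {c : Hom E F}
                 {d : Hom B E} {f : Hom A B} {g : Hom K E} {h : Hom A K} →
                 a ∘ b ≡ c ∘ d → d ∘ f ≡ g ∘ h → a ∘ (b ∘ f) ≡ (c ∘ g) ∘ h
  glue-squares {a = a} {b} {c} {d} {f} {g} {h} left right = begin
    a ∘ (b ∘ f)  ≡⟨ sym assoc ⟩
    (a ∘ b) ∘ f  ≡⟨ cong (_∘ f) left ⟩
    (c ∘ d) ∘ f  ≡⟨ assoc ⟩
    c ∘ (d ∘ f)  ≡⟨ cong (c ∘_) right ⟩
    c ∘ (g ∘ h)  ≡⟨ sym assoc ⟩
    (c ∘ g) ∘ h  ∎

  subst-∘ : ∀ {A B D E} (q : D ≡ E) (f : Hom B D) (h : Hom A B) →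
            subst (Hom A) q (f ∘ h) ≡ subst (Hom B) q f ∘ h
  subst-∘ refl f h = refl

module TransformationGroupoid
    {os ℓs o ℓ c : Level} {S : Category os ℓs} {𝔛 : CFG S o ℓ}
    {G : Set c} {_∙_ : Op₂ G} {e : G} {_⁻¹ : Op₁ G}
    {isG : IsGroup _≡_ _∙_ e _⁻¹} (A : WeakAction 𝔛 isG) where
  open Category (CFG.Tot 𝔛)
  open CategoryLemmas (CFG.Tot 𝔛)
  open WeakAction A
  open ≡-Reasoning
  private module S = Category S

  ι : ∀ {x y} → Hom x y → THom A x y
  ι {y = y} φ = e , (a y ∘ φ)

  THom-castG : ∀ {x y g h} (r : g ≡ h) (γ : Hom x (act₀ y g)) →
               _≡_ {A = THom A x y} (g , γ) (h , (castG r ∘ γ))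
  THom-castG refl γ = cong (_ ,_) (sym identityˡ)

  ι-∘ˡ : ∀ {x y z g} (φ : Hom y z) (δ : Hom x (act₀ y g)) →
         Tcomp A (ι φ) (g , δ) ≡ (g , (act₁ g φ ∘ δ))
  ι-∘ˡ {z = z} {g} φ δ = trans (THom-castG (IsGroup.identityˡ isG g) _)
                               (cong (g ,_) unit-cancels)
    where
    unit-cancels : castG (IsGroup.identityˡ isG g) ∘
                     (α z e g ∘ (act₁ g (a z ∘ φ) ∘ δ)) ≡ act₁ g φ ∘ δ
    unit-cancels = begin
      castG _ ∘ (α z e g ∘ (act₁ g (a z ∘ φ) ∘ δ))
        ≡⟨ cong (λ u → castG _ ∘ (α z e g ∘ (u ∘ δ))) (act-∘ g φ (a z)) ⟩
      castG _ ∘ (α z e g ∘ ((act₁ g (a z) ∘ act₁ g φ) ∘ δ))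
        ≡⟨ cong (λ u → castG _ ∘ (α z e g ∘ u)) assoc ⟩
      castG _ ∘ (α z e g ∘ (act₁ g (a z) ∘ (act₁ g φ ∘ δ)))
        ≡⟨ cancel₃ˡ (coh-unitˡ z g) ⟩
      act₁ g φ ∘ δ
        ∎

  ι-∘ʳ : ∀ {x y z g} (δ : Hom y (act₀ z g)) (φ : Hom x y) →
         Tcomp A (g , δ) (ι φ) ≡ (g , (δ ∘ φ))
  ι-∘ʳ {y = y} {z} {g} δ φ = trans (THom-castG (IsGroup.identityʳ isG g) _)
                                   (cong (g ,_) unit-cancels)
    where
    unit-cancels : castG (IsGroup.identityʳ isG g) ∘
                     (α z g e ∘ (act₁ e δ ∘ (a y ∘ φ))) ≡ δ ∘ φ
    unit-cancels = begin
      castG _ ∘ (α z g e ∘ (act₁ e δ ∘ (a y ∘ φ)))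
        ≡⟨ cong (λ u → castG _ ∘ (α z g e ∘ u)) (sym assoc) ⟩
      castG _ ∘ (α z g e ∘ ((act₁ e δ ∘ a y) ∘ φ))
        ≡⟨ cong (λ u → castG _ ∘ (α z g e ∘ (u ∘ φ))) (sym (a-nat δ)) ⟩
      castG _ ∘ (α z g e ∘ ((a (act₀ z g) ∘ δ) ∘ φ))
        ≡⟨ cong (λ u → castG _ ∘ (α z g e ∘ u)) assoc ⟩
      castG _ ∘ (α z g e ∘ (a (act₀ z g) ∘ (δ ∘ φ)))
        ≡⟨ cancel₃ˡ (coh-unitʳ z g) ⟩
      δ ∘ φ
        ∎

  Tp-ι : ∀ {x y} (φ : Hom x y) → Tp A (ι φ) ≡ p₁ 𝔛 φ
  Tp-ι {x} {y} φ = begin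
    subst (S.Hom (p₀ 𝔛 x)) q (p₁ 𝔛 (a y ∘ φ))
      ≡⟨ cong (subst (S.Hom (p₀ 𝔛 x)) q) (Functor.F-∘ (CFG.p 𝔛) φ (a y)) ⟩
    subst (S.Hom (p₀ 𝔛 x)) q (p₁ 𝔛 (a y) S.∘ p₁ 𝔛 φ)
      ≡⟨ CategoryLemmas.subst-∘ S q (p₁ 𝔛 (a y)) (p₁ 𝔛 φ) ⟩
    subst (S.Hom (p₀ 𝔛 y)) q (p₁ 𝔛 (a y)) S.∘ p₁ 𝔛 φ
      ≡⟨ cong (S._∘ p₁ 𝔛 φ) (a-over y) ⟩
    S.id S.∘ p₁ 𝔛 φ
      ≡⟨ S.identityˡ ⟩
    p₁ 𝔛 φ
      ∎
    where q = act-over₀ y e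

module InducedTwoMorphism
    {os ℓs o ℓ o' ℓ' c : Level} {S : Category os ℓs}
    {𝔛 : CFG S o ℓ} {𝔜 : CFG S o' ℓ'}
    {G : Set c} {_∙_ : Op₂ G} {e : G} {_⁻¹ : Op₁ G}
    {isG : IsGroup _≡_ _∙_ e _⁻¹}
    {A : WeakAction 𝔛 isG} {B : WeakAction 𝔜 isG}
    {F H : EqMor A B} (η : EqTwoMor F H) where
  open Category (CFG.Tot 𝔜)
  open CategoryLemmas (CFG.Tot 𝔜)
  open TransformationGroupoid B
  open ≡-Reasoning
  private
    module A = WeakAction A
    module B = WeakAction B
    module F = EqMor F
    module H = EqMor H
  open EqTwoMor η

  Λ-eq⁻ : ∀ x g → B.act₁ g (Λ x) ∘ F.σ⁻ x g ≡ H.σ⁻ x g ∘ Λ (A.act₀ x g)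
  Λ-eq⁻ x g = invert-square (H.σ-invˡ x g) (F.σ-invʳ x g) (Λ-eq x g)

  ⌊⌋₂-natural : ∀ {x y} (f : THom A x y) →
                Tcomp B (⌊ η ⌋₂ y) (⌊ F ⌋₁ f) ≡ Tcomp B (⌊ H ⌋₁ f) (⌊ η ⌋₂ x)
  ⌊⌋₂-natural {x} {y} (g , γ) = begin
    Tcomp B (ι (Λ y)) (g , (F.σ⁻ y g ∘ F.F₁ γ))
      ≡⟨ ι-∘ˡ (Λ y) _ ⟩
    (g , (B.act₁ g (Λ y) ∘ (F.σ⁻ y g ∘ F.F₁ γ)))
      ≡⟨ cong (g ,_) (glue-squares (Λ-eq⁻ y g) (Λ-nat γ)) ⟩
    (g , ((H.σ⁻ y g ∘ H.F₁ γ) ∘ Λ x))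
      ≡⟨ sym (ι-∘ʳ _ (Λ x)) ⟩
    Tcomp B (g , (H.σ⁻ y g ∘ H.F₁ γ)) (ι (Λ x))
      ∎

  ⌊⌋₂-over : ∀ x → subst (Category.Hom S (p₀ 𝔜 (F.F₀ x)))
                         (trans (H.over₀ x) (sym (F.over₀ x)))
                         (Tp B (⌊ η ⌋₂ x))
                   ≡ Category.id S
  ⌊⌋₂-over x = trans (cong (subst _ _) (Tp-ι (Λ x))) (Λ-over x)

propositionA6 : ∀ {os ℓs o ℓ o' ℓ' c : Level} {S : Category os ℓs}
                  {𝔛 : CFG S o ℓ} {𝔜 : CFG S o' ℓ'}
                  {G : Set c} {_∙_ : Op₂ G} {e : G} {_⁻¹ : Op₁ G}
                  (isG : IsGroup _≡_ _∙_ e _⁻¹)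
                  (A : WeakAction 𝔛 isG) (B : WeakAction 𝔜 isG)
                  (F H : EqMor A B) (Λ : EqTwoMor F H) →
                  IsTG2Mor F H ⌊ Λ ⌋₂
propositionA6 isG A B F H Λ = ⌊⌋₂-natural , ⌊⌋₂-over
  where open InducedTwoMorphism Λ
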